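{- Every $(3,3,6^-)$-face of $G$ is non-poor.
   Context: A $(3,0,0)$-coloring of a graph is an assignment of colors from $\{1,2,3\}$ to its vertices such that every vertex of color $1$ has at most three neighbors of color $1$, and no two adjacent vertices both have color $2$ or both have color $3$. Throughout, $G$ is a fixed plane graph (planar graph with a fixed embedding) containing no cycle of length $4$ or $5$, which has no $(3,0,0)$-coloring but every proper subgraph of which has a $(3,0,0)$-coloring. A $3$-face is a face bounded by a triangle. A $(3,3,6^-)$-face is a $3$-face whose vertices have degrees $3$, $3$, and at most $6$. For a vertex $u$ of degree $3$ on a $3$-face $f$, the pendant neighbor of $u$ is the neighbor of $u$ not on $f$. A $3$-face is non-poor if every degree-$3$ vertex on it has a pendant neighbor of degree at least $6$. -}

module Defs where

open import Data.Nat using (ℕ; zero; suc; _+_; _*_; _≤_; _≤?_)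
open import Data.Nat.DivMod using (_mod_)
open import Data.Fin using (Fin; toℕ) renaming (_≟_ to _≟ᶠ_; zero to fz; suc to fs)
open import Data.Bool using (Bool; true; false; _∧_; _∨_; not; if_then_else_)
open import Data.Product using (Σ; Σ-syntax; ∃; ∃-syntax; _×_)
open import Data.Sum using (_⊎_)
open import Relation.Nullary using (¬_)
open import Data.Empty using (⊥)
open import Relation.Nullary.Decidable using (⌊_⌋)
open import Relation.Binary.PropositionalEquality using (_≡_; _≢_)
open import Function.Definitions using (Injective)

iter : {A : Set} → (A → A) → ℕ → A → A
iter f zero    x = x
iter f (suc k) x = f (iter f k x)

countB : {N : ℕ} → (Fin N → Bool) → ℕ
countB {zero}  p = 0
countB {suc N} p = (if p fz then 1 else 0) + countB (λ i → p (fs i))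

allB : {N : ℕ} → (Fin N → Bool) → Bool
allB {zero}  p = true
allB {suc N} p = p fz ∧ allB (λ i → p (fs i))

anyB : {N : ℕ} → (Fin N → Bool) → Bool
anyB {zero}  p = false
anyB {suc N} p = p fz ∨ anyB (λ i → p (fs i))

cnext : {k : ℕ} → Fin (suc k) → Fin (suc k)
cnext {k} i = suc (toℕ i) mod (suc k)

-- Plane graphs, modelled as combinatorial maps (rotation systems).  Edges: m.  Darts (half-edges): Fin (m + m).
-- head d : the vertex the dart d is attached to,
-- α      : fixed-point-free involution (the other half of the edge),
-- σ      : rotation (cyclic order of darts around each vertex).

Dart : ℕ → Set
Dart m = Fin (m + m)

record RotSys (n m : ℕ) : Set where
  field
    head  : Dart m → Fin n
    α     : Dart m → Dart m
    α-inv : ∀ d → α (α d) ≡ d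
    α-fix : ∀ d → α d ≢ d
    σ     : Dart m → Dart m
    σ⁻    : Dart m → Dart m
    σσ⁻   : ∀ d → σ (σ⁻ d) ≡ d
    σ⁻σ   : ∀ d → σ⁻ (σ d) ≡ d
    σ-head : ∀ d → head (σ d) ≡ head d
    σ-cyclic : ∀ d e → head d ≡ head e → ∃[ k ] iter σ k d ≡ e
    no-loop  : ∀ d → head (α d) ≢ head d
    no-multi : ∀ d e → head d ≡ head e → head (α d) ≡ head (α e) → d ≡ e

  -- face permutation; its orbits are the faces
  φ : Dart m → Dart m
  φ d = σ (α d)

  adjB : Fin n → Fin n → Bool
  adjB v w = anyB (λ d → ⌊ head d ≟ᶠ v ⌋ ∧ ⌊ head (α d) ≟ᶠ w ⌋)

  reach : ℕ → Fin n → Fin n → Bool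
  reach zero    v w = ⌊ v ≟ᶠ w ⌋
  reach (suc k) v w = reach k v w ∨ anyB (λ u → adjB v u ∧ reach k u w)

  -- number of connected components (count the least vertex of each)
  #components : ℕ
  #components = countB (λ v → allB (λ w →
      if reach n v w then ⌊ toℕ v ≤? toℕ w ⌋ else true))

  -- number of φ-orbits (count the least dart of each)
  #faceOrbits : ℕ
  #faceOrbits = countB (λ d → allB {m + m} (λ k →
      ⌊ toℕ d ≤? toℕ (iter φ (toℕ k) d) ⌋))

  #isolated : ℕ
  #isolated = countB (λ v → not (anyB (λ d → ⌊ head d ≟ᶠ v ⌋)))

-- A plane graph: a rotation system of genus 0 in every component
-- (Euler: V - E + F = 2 per non-trivial component, isolated vertices
-- contribute 1 each).
record PlaneGraph (n m : ℕ) : Set where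
  field
    rs     : RotSys n m
  open RotSys rs public
  field
    planar : n + #faceOrbits + #isolated ≡ m + 2 * #components

data Colour : Set where
  col1 col2 col3 : Colour

isCol1 : Colour → Bool
isCol1 col1 = true
isCol1 _    = false

module _ {n m : ℕ} (G : PlaneGraph n m) where
  open PlaneGraph G

  Adj : Fin n → Fin n → Set
  Adj v w = ∃[ d ] (head d ≡ v × head (α d) ≡ w)

  deg : Fin n → ℕ
  deg v = countB (λ d → ⌊ head d ≟ᶠ v ⌋)

  HasCycle : ℕ → Set
  HasCycle zero    = ⊥
  HasCycle (suc k) = Σ[ f ∈ (Fin (suc k) → Fin n) ]
      (Injective _≡_ _≡_ f × (∀ i → Adj (f i) (f (cnext i))))

  -- subgraphs of G: a set of vertices and a set of edges (α-closed dart
  -- sets) whose endpoints are among the chosen vertices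
  record Subgraph : Set where
    field
      inV    : Fin n → Bool
      inE    : Dart m → Bool
      inE-α  : ∀ d → inE (α d) ≡ inE d
      inE-ok : ∀ d → inE d ≡ true → inV (head d) ≡ true

  Proper : Subgraph → Set
  Proper H = (∃[ v ] Subgraph.inV H v ≡ false) ⊎ (∃[ d ] Subgraph.inE H d ≡ false)

  wholeGraph : Subgraph
  wholeGraph = record { inV = λ _ → true ; inE = λ _ → true
                      ; inE-α = λ _ → Relation.Binary.PropositionalEquality.refl
                      ; inE-ok = λ _ _ → Relation.Binary.PropositionalEquality.refl }

  -- (3,0,0)-colouring of a subgraph H (colours of vertices outside H
  -- are irrelevant)
  Is300Colouring : Subgraph → (Fin n → Colour) → Set
  Is300Colouring H c =
      (∀ v → inV v ≡ true → c v ≡ col1 →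
          countB (λ d → ⌊ head d ≟ᶠ v ⌋ ∧ inE d ∧ isCol1 (c (head (α d)))) ≤ 3)
    × (∀ d → inE d ≡ true → ¬ (c (head d) ≡ col2 × c (head (α d)) ≡ col2))
    × (∀ d → inE d ≡ true → ¬ (c (head d) ≡ col3 × c (head (α d)) ≡ col3))
    where open Subgraph H

  Colourable300 : Subgraph → Set
  Colourable300 H = ∃[ c ] Is300Colouring H c

  Critical : Set
  Critical = ¬ Colourable300 wholeGraph
           × (∀ H → Proper H → Colourable300 H)

  NoC4C5 : Set
  NoC4C5 = ¬ HasCycle 4 × ¬ HasCycle 5

  -- a 3-face: a φ-orbit of length 3 (given by one of its darts d);
  -- its vertices are head d, head (φ d), head (φ (φ d))
  Is3Face : Dart m → Set
  Is3Face d = iter φ 3 d ≡ d × φ d ≢ d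

  OnFace : Dart m → Fin n → Set
  OnFace d u = u ≡ head d ⊎ u ≡ head (φ d) ⊎ u ≡ head (φ (φ d))

  Is336Face : Dart m → Set
  Is336Face d = Is3Face d ×
      ((deg x ≡ 3 × deg y ≡ 3 × deg z ≤ 6)
     ⊎ (deg y ≡ 3 × deg z ≡ 3 × deg x ≤ 6)
     ⊎ (deg z ≡ 3 × deg x ≡ 3 × deg y ≤ 6))
    where
      x = head d
      y = head (φ d)
      z = head (φ (φ d))

  NonPoor : Dart m → Set
  NonPoor d = ∀ u → OnFace d u → deg u ≡ 3 →
      ∀ w → Adj u w → ¬ OnFace d w → 6 ≤ deg w

module Submission where

-- After rotating the face, suppose a degree-3 vertex u on a triangle u a b with
-- deg a = 3 and deg b ≤ 6 had a pendant neighbour w with deg w ≤ 5.  By criticality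
-- H = G − {u, a} has a (3,0,0)-colouring c.  As G has no 4-cycles, w is adjacent to
-- neither a nor b, and the third neighbour a' of a is none of u, b, w.  All that matters
-- about c is a finite local view: the colours of b, w, a', whether each already has three
-- colour-1 neighbours in H ("saturated"), and which of the colours 2, 3 occur at
-- neighbours of b and of w in H.  An exhaustive check shows that every local view that a
-- colouring can produce lets us recolour u, a, b, w so that the result is a
-- (3,0,0)-colouring of G, contradicting criticality.

open import Defs
open import Data.Nat using (ℕ; zero; suc; _+_; _≤_; _<_; z≤n; s≤s)
open import Data.Nat.Properties
open import Data.Fin using (Fin) renaming (_≟_ to _≟ᶠ_; zero to fz; suc to fs)
import Data.Fin.Properties as Fin
open import Data.Bool using (Bool; true; false; T; _∧_; _∨_; not; if_then_else_)
open import Data.Bool.Properties using (∧-identityʳ; ∧-comm; ∧-conicalˡ; T-≡; T-∧; T-∨)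
open import Function.Bundles using (Equivalence)
open import Data.Unit using (tt)
open import Data.List using (List; []; _∷_)
open import Data.Bool.ListAction using (and)
open import Data.List.Relation.Unary.All using (All; []; _∷_)
open import Data.Product
open import Data.Sum
open import Data.Empty
open import Function using (_∘_)
open import Relation.Nullary
open import Relation.Nullary.Decidable using (⌊_⌋; ⌊⌋-map′; toSum; fromWitness; toWitness; toWitnessFalse)
open import Relation.Binary.PropositionalEquality hiding ([_])

indicator : Bool → ℕ
indicator b = if b then 1 else 0

indicator-mono : ∀ {x y} → (T x → T y) → indicator x ≤ indicator y
indicator-mono {false} _ = z≤n
indicator-mono {true} {true} _ = ≤-refl
indicator-mono {true} {false} x⇒y = ⊥-elim (x⇒y tt)

count-cong : {N : ℕ} {p q : Fin N → Bool} → (∀ i → p i ≡ q i) → countB p ≡ countB q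
count-cong {zero} _ = refl
count-cong {suc N} p≗q = cong₂ _+_ (cong indicator (p≗q fz)) (count-cong (p≗q ∘ fs))

count-mono : {N : ℕ} {p q : Fin N → Bool} → (∀ i → T (p i) → T (q i)) → countB p ≤ countB q
count-mono {zero} _ = z≤n
count-mono {suc N} p⇒q = +-mono-≤ (indicator-mono (p⇒q fz)) (count-mono (p⇒q ∘ fs))

count-∨ : {N : ℕ} (p q : Fin N → Bool) → countB (λ i → p i ∨ q i) ≤ countB p + countB q
count-∨ {zero} p q = z≤n
count-∨ {suc N} p q with p fz | q fz | count-∨ (p ∘ fs) (q ∘ fs)
... | false | false | ih = ih
... | true | false | ih = s≤s ih
... | false | true | ih = ≤-trans (s≤s ih) (≤-reflexive (sym (+-suc _ _)))
... | true | true | ih = s≤s (≤-trans (m≤n⇒m≤1+n ih) (≤-reflexive (sym (+-suc _ _))))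

count-split : {N : ℕ} (r p q : Fin N → Bool) → (∀ i → T (r i) → T (p i) ⊎ T (q i)) →
  countB r ≤ countB p + countB q
count-split r p q cover =
  ≤-trans (count-mono (λ i ri → Equivalence.from (T-∨ {p i} {q i}) (cover i ri))) (count-∨ p q)

count-none : {N : ℕ} (p : Fin N → Bool) → (∀ i → ¬ T (p i)) → countB p ≡ 0
count-none {zero} p _ = refl
count-none {suc N} p none with p fz | none fz
... | false | _ = count-none (p ∘ fs) (none ∘ fs)
... | true | ¬true = ⊥-elim (¬true tt)

count-witness : {N : ℕ} (p : Fin N → Bool) → 0 < countB p → ∃[ i ] T (p i)
count-witness {suc N} p pos with p fz in e
... | true = fz , subst T (sym e) tt
... | false = let (i , pi) = count-witness (p ∘ fs) pos in fs i , pi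

_without_ : {N : ℕ} → (Fin N → Bool) → Fin N → (Fin N → Bool)
(p without j) i = p i ∧ not ⌊ i ≟ᶠ j ⌋

count-without : {N : ℕ} (p : Fin N → Bool) (j : Fin N) → T (p j) → countB p ≡ suc (countB (p without j))

count-without-suc : {N : ℕ} (p : Fin (suc N) → Bool) (j : Fin N) → T (p (fs j)) →
  countB (p ∘ fs) ≡ suc (countB ((p without fs j) ∘ fs))

count-without {suc N} p fz pj with p fz
... | true = cong suc (count-cong (λ i → sym (∧-identityʳ (p (fs i)))))
count-without {suc N} p (fs j) pj with p fz
... | true = cong suc (count-without-suc p j pj)
... | false = count-without-suc p j pj
count-without-suc p j pj = trans (count-without (p ∘ fs) j pj)
  (cong suc (count-cong λ i →
    cong (λ b → p (fs i) ∧ not b) (sym (⌊⌋-map′ (cong fs) Fin.suc-injective (i ≟ᶠ j)))))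

without-intro : {N : ℕ} (p : Fin N → Bool) {i j : Fin N} → T (p i) → i ≢ j → T ((p without j) i)
without-intro p {i} {j} pi i≢j with p i | i ≟ᶠ j
... | true | no _ = tt
... | true | yes i≡j = i≢j i≡j

without-elim : {N : ℕ} (p : Fin N → Bool) {i j : Fin N} → T ((p without j) i) → T (p i) × i ≢ j
without-elim p {i} {j} h with p i | i ≟ᶠ j
... | true | no i≢j = tt , i≢j

count-drop : {N : ℕ} {p q : Fin N → Bool} (j : Fin N) → T (q j) →
  (∀ i → T (p i) → T (q i) × i ≢ j) → suc (countB p) ≤ countB q
count-drop {p = p} {q} j qj p⇒q = begin
  suc (countB p)             ≤⟨ s≤s (count-mono (λ i pi → uncurry (without-intro q) (p⇒q i pi))) ⟩
  suc (countB (q without j)) ≡⟨ sym (count-without q j qj) ⟩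
  countB q                   ∎
  where open ≤-Reasoning

count-pos : {N : ℕ} (p : Fin N → Bool) {i : Fin N} → T (p i) → 0 < countB p
count-pos p {i} pi = ≤-trans (s≤s z≤n) (count-drop {p = λ _ → false} i pi (λ _ ()))

count-≤1 : {N : ℕ} (p : Fin N → Bool) → (∀ i j → T (p i) → T (p j) → i ≡ j) → countB p ≤ 1
count-≤1 {zero} p uniq = z≤n
count-≤1 {suc N} p uniq with p fz in e
... | false = count-≤1 (p ∘ fs) (λ i j pi pj → Fin.suc-injective (uniq _ _ pi pj))
... | true = s≤s (≤-reflexive (count-none (p ∘ fs)
                   (λ i pi → Fin.0≢1+n (uniq fz (fs i) (subst T (sym e) tt) pi))))

count-unique : {N : ℕ} (p : Fin N → Bool) → countB p ≡ 1 → ∀ {i j} → T (p i) → T (p j) → i ≡ j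
count-unique p one {i} {j} pi pj with i ≟ᶠ j
... | yes i≡j = i≡j
... | no i≢j = ⊥-elim (<-irrefl (sym rest≡0) (count-pos (p without i) (without-intro p pj (i≢j ∘ sym))))
  where
  rest≡0 : countB (p without i) ≡ 0
  rest≡0 = suc-injective (trans (sym (count-without p i pi)) one)

∧-split : ∀ {x y} → T (x ∧ y) → T x × T y
∧-split = Equivalence.to T-∧

∧-join : ∀ {x y} → T x → T y → T (x ∧ y)
∧-join tx ty = Equivalence.from T-∧ (tx , ty)

≟-sound : ∀ {N} {x y : Fin N} → T ⌊ x ≟ᶠ y ⌋ → x ≡ y
≟-sound {x = x} {y} = toWitness {a? = x ≟ᶠ y}

≟-complete : ∀ {N} {x y : Fin N} → x ≡ y → T ⌊ x ≟ᶠ y ⌋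
≟-complete {x = x} {y} = fromWitness {a? = x ≟ᶠ y}

isCol1-sound : ∀ {x} → T (isCol1 x) → x ≡ col1
isCol1-sound {col1} _ = refl

isCol1-complete : ∀ {x} → x ≡ col1 → T (isCol1 x)
isCol1-complete refl = tt

not-T : ∀ {x} → T (not x) → T x → ⊥
not-T {false} _ ()

-- the number of colour-1 neighbours a colour-1 vertex may already have:
-- 3 when it is saturated (has three of them), 2 otherwise
cap : Bool → ℕ
cap s = if s then 3 else 2

_≟ᶜ_ : (x y : Colour) → Dec (x ≡ y)
col1 ≟ᶜ col1 = yes refl
col1 ≟ᶜ col2 = no λ ()
col1 ≟ᶜ col3 = no λ ()
col2 ≟ᶜ col1 = no λ ()
col2 ≟ᶜ col2 = yes refl
col2 ≟ᶜ col3 = no λ ()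
col3 ≟ᶜ col1 = no λ ()
col3 ≟ᶜ col2 = no λ ()
col3 ≟ᶜ col3 = yes refl

_⇒ᵇ_ : Bool → Bool → Bool
x ⇒ᵇ y = not x ∨ y

⇒ᵇ-sound : ∀ {x y} → T (x ⇒ᵇ y) → T x → T y
⇒ᵇ-sound {true} h _ = h

not-both : ∀ {x y} → (T x → T y → ⊥) → T (not (x ∧ y))
not-both {false} _ = tt
not-both {true} {false} _ = tt
not-both {true} {true} h = h tt tt

not-both-sound : ∀ {x y} → T (not (x ∧ y)) → T x → T y → ⊥
not-both-sound {true} {true} ()

is : Colour → Colour → Bool
is t x = ⌊ x ≟ᶜ t ⌋

is-sound : ∀ {t x} → T (is t x) → x ≡ t
is-sound {t} {x} = toWitness {a? = x ≟ᶜ t}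

is-complete : ∀ {t x} → x ≡ t → T (is t x)
is-complete {t} {x} = fromWitness {a? = x ≟ᶜ t}

clash : Colour → Colour → Bool
clash x y = ⌊ x ≟ᶜ y ⌋ ∧ not (isCol1 x)

pair : ∀ {N} → Fin N → Fin N → Fin N → Bool
pair x y z = ⌊ z ≟ᶠ x ⌋ ∨ ⌊ z ≟ᶠ y ⌋

pair-fst : ∀ {N} (x y : Fin N) → T (pair x y x)
pair-fst x y with x ≟ᶠ x
... | yes _ = tt
... | no x≢x = ⊥-elim (x≢x refl)

pair-snd : ∀ {N} (x y : Fin N) → T (pair x y y)
pair-snd x y with y ≟ᶠ x | y ≟ᶠ y
... | yes _ | _ = tt
... | no _ | yes _ = tt
... | no _ | no y≢y = ⊥-elim (y≢y refl)

pair-out : ∀ {N} {x y z : Fin N} → z ≢ x → z ≢ y → T (not (pair x y z))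
pair-out {x = x} {y} {z} z≢x z≢y with z ≟ᶠ x | z ≟ᶠ y
... | yes z≡x | _ = ⊥-elim (z≢x z≡x)
... | no _ | yes z≡y = ⊥-elim (z≢y z≡y)
... | no _ | no _ = tt

pair-not : ∀ {N} {x y z : Fin N} → T (not (pair x y z)) → z ≢ x × z ≢ y
pair-not {x = x} {y} z∉ = (λ { refl → not-T z∉ (pair-fst x y) }) , (λ { refl → not-T z∉ (pair-snd x y) })

_[_↦_] : ∀ {N} → (Fin N → Colour) → Fin N → Colour → (Fin N → Colour)
(κ [ x ↦ t ]) z = if ⌊ z ≟ᶠ x ⌋ then t else κ z

update-here : ∀ {N} (κ : Fin N → Colour) x t → (κ [ x ↦ t ]) x ≡ t
update-here κ x t with x ≟ᶠ x
... | yes _ = refl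
... | no x≢x = ⊥-elim (x≢x refl)

update-there : ∀ {N} (κ : Fin N → Colour) {x z} t → z ≢ x → (κ [ x ↦ t ]) z ≡ κ z
update-there κ {x} {z} t z≢x with z ≟ᶠ x
... | yes z≡x = ⊥-elim (z≢x z≡x)
... | no _ = refl

-- The local picture of a colouring c of G − {u, a} around the configuration of
-- Configuration below: the colours of b, w, a' in c, whether they are saturated, and
-- whether b and w have a neighbour of colour 2 or 3 in G − {u, a}.
record LocalView : Set where
  constructor view
  field
    colour-b colour-w colour-a' : Colour
    sat-b sat-w sat-a' : Bool
    b-has2 b-has3 w-has2 w-has3 : Bool

-- what every local view of an actual colouring satisfies (b and w have degree at most 4
-- in G − {u, a}, so a saturated one cannot also see both colours 2 and 3)
record Consistent (l : LocalView) : Set where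
  open LocalView l
  field
    b-no2 : colour-b ≡ col2 → ¬ T b-has2
    b-no3 : colour-b ≡ col3 → ¬ T b-has3
    w-no2 : colour-w ≡ col2 → ¬ T w-has2
    w-no3 : colour-w ≡ col3 → ¬ T w-has3
    b-uncrowded : T sat-b → T b-has2 → T b-has3 → ⊥
    w-uncrowded : T sat-w → T w-has2 → T w-has3 → ⊥

NoClash : Colour → Colour → Set
NoClash x y = ∀ t → t ≢ col1 → x ≡ t → y ≡ t → ⊥

no-clash : ∀ {x y} → T (not (clash x y)) → NoClash x y
no-clash h col1 t≢1 refl refl = t≢1 refl
no-clash h col2 _ refl refl = h
no-clash h col3 _ refl refl = h

-- new colours nu, na, nb, nw for u, a, b, w that extend the colouring: the edges
-- ua, ub, uw, ab, aa' are fine, b and w only lose colour 1, do not clash with their other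
-- neighbours, and no vertex of colour 1 gets more than three neighbours of colour 1
record Extension (l : LocalView) (nu na nb nw : Colour) : Set where
  open LocalView l
  field
    u-a : NoClash nu na
    u-b : NoClash nu nb
    u-w : NoClash nu nw
    a-b : NoClash na nb
    a-a' : NoClash na colour-a'
    b-keeps1 : nb ≡ col1 → colour-b ≡ col1
    w-keeps1 : nw ≡ col1 → colour-w ≡ col1
    b-avoids2 : nb ≡ col2 → ¬ T b-has2
    b-avoids3 : nb ≡ col3 → ¬ T b-has3
    w-avoids2 : nw ≡ col2 → ¬ T w-has2
    w-avoids3 : nw ≡ col3 → ¬ T w-has3
    b-room : nb ≡ col1 → cap sat-b + indicator (isCol1 nu) + indicator (isCol1 na) ≤ 3
    w-room : nw ≡ col1 → cap sat-w + indicator (isCol1 nu) ≤ 3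
    a'-room : colour-a' ≡ col1 → cap sat-a' + indicator (isCol1 na) ≤ 3

consistent : LocalView → Bool
consistent (view cb cw ca sb sw sa b2 b3 w2 w3) = and
  ( not (is col2 cb ∧ b2) ∷ not (is col3 cb ∧ b3) ∷ not (is col2 cw ∧ w2) ∷ not (is col3 cw ∧ w3)
  ∷ not (sb ∧ b2 ∧ b3) ∷ not (sw ∧ w2 ∧ w3) ∷ [])

extensionConditions : LocalView → (nu na nb nw : Colour) → List Bool
extensionConditions (view cb cw ca sb sw sa b2 b3 w2 w3) nu na nb nw =
  ( not (clash nu na) ∷ not (clash nu nb) ∷ not (clash nu nw) ∷ not (clash na nb) ∷ not (clash na ca)
  ∷ (isCol1 nb ⇒ᵇ isCol1 cb) ∷ (isCol1 nw ⇒ᵇ isCol1 cw)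
  ∷ not (is col2 nb ∧ b2) ∷ not (is col3 nb ∧ b3) ∷ not (is col2 nw ∧ w2) ∷ not (is col3 nw ∧ w3)
  ∷ (isCol1 nb ⇒ᵇ ⌊ cap sb + indicator (isCol1 nu) + indicator (isCol1 na) ≤? 3 ⌋)
  ∷ (isCol1 nw ⇒ᵇ ⌊ cap sw + indicator (isCol1 nu) ≤? 3 ⌋)
  ∷ (isCol1 ca ⇒ᵇ ⌊ cap sa + indicator (isCol1 na) ≤? 3 ⌋) ∷ [])

anyColour : (Colour → Bool) → Bool
anyColour p = p col1 ∨ p col2 ∨ p col3

extendable : LocalView → Bool
extendable l = anyColour λ nu → anyColour λ na → anyColour λ nb → anyColour λ nw →
  and (extensionConditions l nu na nb nw)

-- finite universal quantifiers as records, so that a table of all cases can be built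
-- by the type checker
record ∀Colour (P : Colour → Set) : Set where
  field
    at1 : P col1
    at2 : P col2
    at3 : P col3

record ∀Bool (P : Bool → Set) : Set where
  field
    atT : P true
    atF : P false

∀Colour-at : {P : Colour → Set} → ∀Colour P → (x : Colour) → P x
∀Colour-at h col1 = ∀Colour.at1 h
∀Colour-at h col2 = ∀Colour.at2 h
∀Colour-at h col3 = ∀Colour.at3 h

∀Bool-at : {P : Bool → Set} → ∀Bool P → (x : Bool) → P x
∀Bool-at h true = ∀Bool.atT h
∀Bool-at h false = ∀Bool.atF h

-- The exhaustive check: each of the 3³·2⁷ consistent local views extends.
-- Every leaf of the table computes to T true, so the type checker fills it in.
extension-table : ∀Colour λ cb → ∀Colour λ cw → ∀Colour λ ca → ∀Bool λ sb → ∀Bool λ sw → ∀Bool λ sa →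
  ∀Bool λ b2 → ∀Bool λ b3 → ∀Bool λ w2 → ∀Bool λ w3 →
  T (consistent (view cb cw ca sb sw sa b2 b3 w2 w3) ⇒ᵇ extendable (view cb cw ca sb sw sa b2 b3 w2 w3))
extension-table = _

anyColour-sound : (p : Colour → Bool) → T (anyColour p) → ∃[ x ] T (p x)
anyColour-sound p h with p col1 in e₁ | p col2 in e₂ | p col3 in e₃
... | true | _ | _ = col1 , subst T (sym e₁) tt
... | false | true | _ = col2 , subst T (sym e₂) tt
... | false | false | true = col3 , subst T (sym e₃) tt

T-and : ∀ bs → T (and bs) → All T bs
T-and [] _ = []
T-and (true ∷ bs) h = tt ∷ T-and bs h
T-and (false ∷ bs) ()

and-T : ∀ {bs} → All T bs → T (and bs)
and-T [] = tt
and-T {true ∷ _} (_ ∷ hs) = and-T hs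

consistent-T : (l : LocalView) → Consistent l → T (consistent l)
consistent-T (view cb cw ca sb sw sa b2 b3 w2 w3) ok = and-T
  ( not-both (b-no2 ∘ is-sound) ∷ not-both (b-no3 ∘ is-sound)
  ∷ not-both (w-no2 ∘ is-sound) ∷ not-both (w-no3 ∘ is-sound)
  ∷ not-both (λ s h → b-uncrowded s (∧-split {b2} h .proj₁) (∧-split {b2} h .proj₂))
  ∷ not-both (λ s h → w-uncrowded s (∧-split {w2} h .proj₁) (∧-split {w2} h .proj₂)) ∷ [])
  where open Consistent ok

extension-sound : ∀ l nu na nb nw → All T (extensionConditions l nu na nb nw) → Extension l nu na nb nw
extension-sound (view cb cw ca sb sw sa b2 b3 w2 w3) nu na nb nw
  (ua ∷ ub ∷ uw ∷ ab ∷ aa' ∷ b1 ∷ w1 ∷ b2' ∷ b3' ∷ w2' ∷ w3' ∷ broom ∷ wroom ∷ a'room ∷ []) = record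
  { u-a = no-clash ua ; u-b = no-clash ub ; u-w = no-clash uw ; a-b = no-clash ab ; a-a' = no-clash aa'
  ; b-keeps1 = keeps1 b1 ; w-keeps1 = keeps1 w1
  ; b-avoids2 = avoids b2' ; b-avoids3 = avoids b3' ; w-avoids2 = avoids w2' ; w-avoids3 = avoids w3'
  ; b-room = room broom ; w-room = room wroom ; a'-room = room a'room }
  where
  keeps1 : ∀ {x y} → T (isCol1 x ⇒ᵇ isCol1 y) → x ≡ col1 → y ≡ col1
  keeps1 h = isCol1-sound ∘ ⇒ᵇ-sound h ∘ isCol1-complete
  avoids : ∀ {x t f} → T (not (is t x ∧ f)) → x ≡ t → ¬ T f
  avoids h x≡t = not-both-sound h (is-complete x≡t)
  room : ∀ {x k} → T (isCol1 x ⇒ᵇ ⌊ k ≤? 3 ⌋) → x ≡ col1 → k ≤ 3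
  room h = toWitness ∘ ⇒ᵇ-sound h ∘ isCol1-complete

extension : (l : LocalView) → Consistent l → ∃[ nu ] ∃[ na ] ∃[ nb ] ∃[ nw ] Extension l nu na nb nw
extension l@(view cb cw ca sb sw sa b2 b3 w2 w3) ok =
  let (nu , h₁) = anyColour-sound
                    (λ nu → anyColour λ na → anyColour λ nb → anyColour λ nw → found nu na nb nw) table-entry
      (na , h₂) = anyColour-sound (λ na → anyColour λ nb → anyColour λ nw → found nu na nb nw) h₁
      (nb , h₃) = anyColour-sound (λ nb → anyColour λ nw → found nu na nb nw) h₂
      (nw , h₄) = anyColour-sound (λ nw → found nu na nb nw) h₃
  in nu , na , nb , nw , extension-sound l nu na nb nw (T-and (extensionConditions l nu na nb nw) h₄)
  where
  found : (nu na nb nw : Colour) → Bool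
  found nu na nb nw = and (extensionConditions l nu na nb nw)
  table-entry : T (extendable l)
  table-entry = ⇒ᵇ-sound (∀Bool-at (∀Bool-at (∀Bool-at (∀Bool-at (∀Bool-at (∀Bool-at (∀Bool-at
    (∀Colour-at (∀Colour-at (∀Colour-at extension-table cb) cw) ca) sb) sw) sa) b2) b3) w2) w3)
    (consistent-T l ok)

module _ {n m : ℕ} (G : PlaneGraph n m) where
  open PlaneGraph G

  at : Fin n → Dart m → Bool
  at v d = ⌊ head d ≟ᶠ v ⌋

  Adj-sym : ∀ {x y} → Adj G x y → Adj G y x
  Adj-sym (d , hd , tl) = α d , tl , trans (cong head (α-inv d)) hd

  Adj-irrefl : ∀ {x y} → Adj G x y → x ≢ y
  Adj-irrefl (d , refl , tl) x≡y = no-loop d (trans tl (sym x≡y))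

  dart-unique : ∀ {d e} → head d ≡ head e → head (α d) ≡ head (α e) → d ≡ e
  dart-unique = no-multi _ _

  -- a closed walk p q r s with p ≢ r, q ≢ s (and hence all four distinct) is a 4-cycle
  no-4-cycle : NoC4C5 G → ∀ {p q r s} → Adj G p q → Adj G q r → Adj G r s → Adj G s p →
    p ≢ r → q ≢ s → ⊥
  no-4-cycle (noC4 , _) {p} {q} {r} {s} pq qr rs sp p≢r q≢s = noC4 (walk , injective , step)
    where
    walk : Fin 4 → Fin n
    walk fz = p
    walk (fs fz) = q
    walk (fs (fs fz)) = r
    walk (fs (fs (fs fz))) = s
    p≢q = Adj-irrefl pq
    q≢r = Adj-irrefl qr
    r≢s = Adj-irrefl rs
    s≢p = Adj-irrefl sp
    injective : ∀ {i j} → walk i ≡ walk j → i ≡ j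
    injective {fz} {fz} _ = refl
    injective {fz} {fs fz} e = ⊥-elim (p≢q e)
    injective {fz} {fs (fs fz)} e = ⊥-elim (p≢r e)
    injective {fz} {fs (fs (fs fz))} e = ⊥-elim (s≢p (sym e))
    injective {fs fz} {fz} e = ⊥-elim (p≢q (sym e))
    injective {fs fz} {fs fz} _ = refl
    injective {fs fz} {fs (fs fz)} e = ⊥-elim (q≢r e)
    injective {fs fz} {fs (fs (fs fz))} e = ⊥-elim (q≢s e)
    injective {fs (fs fz)} {fz} e = ⊥-elim (p≢r (sym e))
    injective {fs (fs fz)} {fs fz} e = ⊥-elim (q≢r (sym e))
    injective {fs (fs fz)} {fs (fs fz)} _ = refl
    injective {fs (fs fz)} {fs (fs (fs fz))} e = ⊥-elim (r≢s e)
    injective {fs (fs (fs fz))} {fz} e = ⊥-elim (s≢p e)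
    injective {fs (fs (fs fz))} {fs fz} e = ⊥-elim (q≢s (sym e))
    injective {fs (fs (fs fz))} {fs (fs fz)} e = ⊥-elim (r≢s (sym e))
    injective {fs (fs (fs fz))} {fs (fs (fs fz))} _ = refl
    step : ∀ i → Adj G (walk i) (walk (cnext i))
    step fz = pq
    step (fs fz) = qr
    step (fs (fs fz)) = rs
    step (fs (fs (fs fz))) = sp

  deg3-darts : ∀ {v d₁ d₂} → deg G v ≡ 3 → head d₁ ≡ v → head d₂ ≡ v → d₁ ≢ d₂ →
    ∃[ d₃ ] head d₃ ≡ v × d₃ ≢ d₁ × d₃ ≢ d₂ × (∀ e → head e ≡ v → e ≡ d₁ ⊎ e ≡ d₂ ⊎ e ≡ d₃)
  deg3-darts {v} {d₁} {d₂} deg≡3 h₁ h₂ d₁≢d₂ =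
    d₃ , ≟-sound at-d₃ , d₃≢d₁ , d₃≢d₂ , classify
    where
    others : Dart m → Bool
    others = (at v without d₁) without d₂
    one-other : countB others ≡ 1
    one-other = suc-injective (suc-injective (sym (begin
      3                                  ≡⟨ sym deg≡3 ⟩
      countB (at v)                      ≡⟨ count-without (at v) d₁ (≟-complete h₁) ⟩
      suc (countB (at v without d₁))     ≡⟨ cong suc (count-without (at v without d₁) d₂
                                              (without-intro (at v) (≟-complete h₂) (d₁≢d₂ ∘ sym))) ⟩
      suc (suc (countB others))          ∎)))
      where open ≡-Reasoning
    witness = count-witness others (≤-reflexive (sym one-other))
    d₃ = proj₁ witness
    at-d₃ = proj₁ (without-elim (at v) (proj₁ (without-elim (at v without d₁) (proj₂ witness))))
    d₃≢d₁ = proj₂ (without-elim (at v) (proj₁ (without-elim (at v without d₁) (proj₂ witness))))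
    d₃≢d₂ = proj₂ (without-elim (at v without d₁) (proj₂ witness))
    classify : ∀ e → head e ≡ v → e ≡ d₁ ⊎ e ≡ d₂ ⊎ e ≡ d₃
    classify e he with e ≟ᶠ d₁ | e ≟ᶠ d₂
    ... | yes e≡d₁ | _ = inj₁ e≡d₁
    ... | no _ | yes e≡d₂ = inj₂ (inj₁ e≡d₂)
    ... | no e≢d₁ | no e≢d₂ = inj₂ (inj₂ (count-unique others one-other
            (without-intro (at v without d₁) (without-intro (at v) (≟-complete he) e≢d₁) e≢d₂)
            (proj₂ witness)))

  deg3-nbhd : ∀ {v x₁ x₂} → deg G v ≡ 3 → Adj G v x₁ → Adj G v x₂ → x₁ ≢ x₂ →
    ∃[ y ] Adj G v y × y ≢ x₁ × y ≢ x₂ × (∀ {z} → Adj G v z → z ≡ x₁ ⊎ z ≡ x₂ ⊎ z ≡ y)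
  deg3-nbhd {v} {x₁} {x₂} deg≡3 (d₁ , h₁ , t₁) (d₂ , h₂ , t₂) x₁≢x₂
    with deg3-darts deg≡3 h₁ h₂ (λ { refl → x₁≢x₂ (trans (sym t₁) t₂) })
  ... | d₃ , h₃ , d₃≢d₁ , d₃≢d₂ , classify =
    head (α d₃) , (d₃ , h₃ , refl) ,
    (λ y≡x₁ → d₃≢d₁ (dart-unique (trans h₃ (sym h₁)) (trans y≡x₁ (sym t₁)))) ,
    (λ y≡x₂ → d₃≢d₂ (dart-unique (trans h₃ (sym h₂)) (trans y≡x₂ (sym t₂)))) ,
    neighbour
    where
    neighbour : ∀ {z} → Adj G v z → z ≡ x₁ ⊎ z ≡ x₂ ⊎ z ≡ head (α d₃)
    neighbour (e , he , refl) with classify e he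
    ... | inj₁ refl = inj₁ t₁
    ... | inj₂ (inj₁ refl) = inj₂ (inj₁ t₂)
    ... | inj₂ (inj₂ refl) = inj₂ (inj₂ refl)

  delete : (Fin n → Bool) → Subgraph G
  delete S = record
    { inV = λ v → not (S v)
    ; inE = λ d → not (S (head d)) ∧ not (S (head (α d)))
    ; inE-α = λ d → trans (cong (λ e → not (S (head (α d))) ∧ not (S (head e))) (α-inv d))
                          (∧-comm (not (S (head (α d)))) (not (S (head d))))
    ; inE-ok = λ d → ∧-conicalˡ _ _ }

  delete-proper : ∀ S {v} → T (S v) → Proper G (delete S)
  delete-proper S {v} v∈S = inj₁ (v , cong not (Equivalence.to T-≡ v∈S))

  deleted-tail : ∀ S {d} → T (Subgraph.inE (delete S) d) → T (not (S (head (α d))))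
  deleted-tail S {d} h = ∧-split {not (S (head d))} h .proj₂

  degIn : Subgraph G → Fin n → ℕ
  degIn H v = countB (λ d → at v d ∧ Subgraph.inE H d)

  delete-darts : ∀ S {v x e} → head e ≡ v → head (α e) ≡ x → T (S x) →
    ∀ d → T (at v d ∧ Subgraph.inE (delete S) d) → T (at v d) × d ≢ e
  delete-darts S refl refl x∈S d h =
    ∧-split {at _ d} h .proj₁ , λ { refl → not-T (deleted-tail S (∧-split {at _ d} h .proj₂)) x∈S }

  degIn-delete₁ : ∀ S {v x} → Adj G v x → T (S x) → suc (degIn (delete S) v) ≤ deg G v
  degIn-delete₁ S (e , he , te) x∈S = count-drop e (≟-complete he) (delete-darts S he te x∈S)

  degIn-delete₂ : ∀ S {v x y} → Adj G v x → Adj G v y → x ≢ y → T (S x) → T (S y) →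
    suc (suc (degIn (delete S) v)) ≤ deg G v
  degIn-delete₂ S {v} (e , he , te) (e' , he' , te') x≢y x∈S y∈S = begin
    suc (suc (degIn (delete S) v))   ≤⟨ s≤s (count-drop e' e'-remains both-removed) ⟩
    suc (countB (at v without e))    ≡⟨ sym (count-without (at v) e (≟-complete he)) ⟩
    deg G v                          ∎
    where
    open ≤-Reasoning
    e'-remains : T ((at v without e) e')
    e'-remains = without-intro (at v) (≟-complete he') λ { refl → x≢y (trans (sym te) te') }
    both-removed : ∀ d → T (at v d ∧ Subgraph.inE (delete S) d) → T ((at v without e) d) × d ≢ e'
    both-removed d h =
      uncurry (without-intro (at v)) (delete-darts S he te x∈S d h) , delete-darts S he' te' y∈S d h .proj₂

  ones : Subgraph G → (Fin n → Colour) → Fin n → ℕ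
  ones H κ v = countB (λ d → ⌊ head d ≟ᶠ v ⌋ ∧ Subgraph.inE H d ∧ isCol1 (κ (head (α d))))

  ones-≤-deg : ∀ H κ v → ones H κ v ≤ deg G v
  ones-≤-deg H κ v = count-mono λ d h → ∧-split {at v d} h .proj₁

  edgeTo : Fin n → Fin n → Dart m → Bool
  edgeTo v x d = at v d ∧ ⌊ head (α d) ≟ᶠ x ⌋

  edgeTo-sound : ∀ {v x d} → T (edgeTo v x d) → head d ≡ v × head (α d) ≡ x
  edgeTo-sound h = ≟-sound (∧-split h .proj₁) , ≟-sound (∧-split h .proj₂)

  onesTo : (Fin n → Colour) → Fin n → Fin n → ℕ
  onesTo κ v x = countB (λ d → edgeTo v x d ∧ isCol1 (κ x))

  onesTo-≤ : ∀ κ v x → onesTo κ v x ≤ indicator (isCol1 (κ x))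
  onesTo-≤ κ v x with isCol1 (κ x)
  ... | true = count-≤1 (λ d → edgeTo v x d ∧ true) λ d e hd he →
        let (hd-v , td-x) = edgeTo-sound (∧-split hd .proj₁)
            (he-v , te-x) = edgeTo-sound (∧-split he .proj₁)
        in dart-unique (trans hd-v (sym he-v)) (trans td-x (sym te-x))
  ... | false = ≤-reflexive (count-none (λ d → edgeTo v x d ∧ false) λ d h → ∧-split h .proj₂)

  onesTo-nonadj : ∀ κ {v x} → ¬ Adj G v x → onesTo κ v x ≡ 0
  onesTo-nonadj κ {v} {x} ¬vx = count-none (λ d → edgeTo v x d ∧ isCol1 (κ x)) λ d h →
    ¬vx (d , edgeTo-sound (∧-split h .proj₁))

  ones-split : ∀ S κ c → (∀ x → T (not (S x)) → κ x ≡ col1 → c x ≡ col1) → ∀ {v} → T (not (S v)) →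
    ones (wholeGraph G) κ v ≤
      ones (delete S) c v + countB (λ d → at v d ∧ S (head (α d)) ∧ isCol1 (κ (head (α d))))
  ones-split S κ c keeps-1 {v} v∉S = count-split _ _ _ classify
    where
    classify : ∀ d → T (at v d ∧ true ∧ isCol1 (κ (head (α d)))) →
      T (at v d ∧ (not (S (head d)) ∧ not (S (head (α d)))) ∧ isCol1 (c (head (α d))))
      ⊎ T (at v d ∧ S (head (α d)) ∧ isCol1 (κ (head (α d))))
    classify d h with S (head (α d)) in tail∈S
    ... | true = inj₂ h
    ... | false = inj₁ (∧-join at-v (∧-join (∧-join head∉S tt) tail-1))
      where
      at-v : T (at v d)
      at-v = ∧-split h .proj₁
      head∉S : T (not (S (head d)))
      head∉S = subst (λ x → T (not (S x))) (sym (≟-sound at-v)) v∉S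
      tail-1 : T (isCol1 (c (head (α d))))
      tail-1 = isCol1-complete (keeps-1 (head (α d)) (subst (T ∘ not) (sym tail∈S) tt)
                                        (isCol1-sound (∧-split {at v d} h .proj₂)))

  ones-pair : ∀ κ v x y →
    countB (λ d → at v d ∧ pair x y (head (α d)) ∧ isCol1 (κ (head (α d)))) ≤ onesTo κ v x + onesTo κ v y
  ones-pair κ v x y = count-split _ _ _ classify
    where
    classify : ∀ d → T (at v d ∧ pair x y (head (α d)) ∧ isCol1 (κ (head (α d)))) →
      T (edgeTo v x d ∧ isCol1 (κ x)) ⊎ T (edgeTo v y d ∧ isCol1 (κ y))
    classify d h with head (α d) ≟ᶠ x | head (α d) ≟ᶠ y
    ... | yes refl | _ = inj₁ (∧-join (∧-join (∧-split {at v d} h .proj₁) tt) (∧-split {at v d} h .proj₂))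
    ... | no _ | yes refl = inj₂ (∧-join (∧-join (∧-split {at v d} h .proj₁) tt) (∧-split {at v d} h .proj₂))
    ... | no _ | no _ = ⊥-elim (∧-split {at v d} h .proj₂)

  saturated : Subgraph G → (Fin n → Colour) → Fin n → Bool
  saturated H c v = not ⌊ ones H c v ≤? 2 ⌋

  ones-cap : ∀ H c → Is300Colouring G H c → ∀ {v} → Subgraph.inV H v ≡ true → c v ≡ col1 →
    ones H c v ≤ cap (saturated H c v)
  ones-cap H c c-ok {v} v∈H cv with ones H c v ≤? 2
  ... | yes ≤2 = ≤2
  ... | no _ = proj₁ c-ok v v∈H cv

  towards : Subgraph G → (Fin n → Colour) → Colour → Fin n → Dart m → Bool
  towards H c t v d = at v d ∧ Subgraph.inE H d ∧ ⌊ c (head (α d)) ≟ᶜ t ⌋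

  towards-sound : ∀ H c t {v d} → T (towards H c t v d) →
    head d ≡ v × T (Subgraph.inE H d) × c (head (α d)) ≡ t
  towards-sound H c t {v} {d} h =
    ≟-sound (∧-split {at v d} h .proj₁) ,
    ∧-split {Subgraph.inE H d} (∧-split {at v d} h .proj₂) .proj₁ ,
    toWitness (∧-split {Subgraph.inE H d} (∧-split {at v d} h .proj₂) .proj₂)

  hasNbr : Subgraph G → (Fin n → Colour) → Colour → Fin n → Bool
  hasNbr H c t v = ⌊ 1 ≤? countB (towards H c t v) ⌋

  hasNbr-intro : ∀ H c t {v d} → T (towards H c t v d) → T (hasNbr H c t v)
  hasNbr-intro H c t {v} h = fromWitness (count-pos (towards H c t v) h)

  hasNbr-elim : ∀ H c t {v} → T (hasNbr H c t v) → ∃[ d ] T (towards H c t v d)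
  hasNbr-elim H c t {v} h = count-witness (towards H c t v) (toWitness h)

  NoMonoEdge : Subgraph G → (Fin n → Colour) → Set
  NoMonoEdge H c =
    ∀ t → t ≢ col1 → ∀ d → Subgraph.inE H d ≡ true → ¬ (c (head d) ≡ t × c (head (α d)) ≡ t)

  no-mono-edge : ∀ H c → Is300Colouring G H c → NoMonoEdge H c
  no-mono-edge H c c-ok col1 t≢1 = ⊥-elim (t≢1 refl)
  no-mono-edge H c c-ok col2 _ = proj₁ (proj₂ c-ok)
  no-mono-edge H c c-ok col3 _ = proj₂ (proj₂ c-ok)

  colouring-intro : ∀ H c → (∀ v → Subgraph.inV H v ≡ true → c v ≡ col1 → ones H c v ≤ 3) →
    NoMonoEdge H c → Is300Colouring G H c
  colouring-intro H c ones-ok no-mono = ones-ok , no-mono col2 (λ ()) , no-mono col3 (λ ())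

  no-same-nbr : ∀ H c → Is300Colouring G H c → ∀ t → t ≢ col1 → ∀ {v} → c v ≡ t → ¬ T (hasNbr H c t v)
  no-same-nbr H c c-ok t t≢1 cv has with hasNbr-elim H c t has
  ... | d , h with towards-sound H c t h
  ... | refl , d∈H , ct = no-mono-edge H c c-ok t t≢1 d (Equivalence.to T-≡ d∈H) (cv , ct)

  crowded : ∀ H c v → degIn H v ≤ 4 → T (saturated H c v) →
    T (hasNbr H c col2 v) → T (hasNbr H c col3 v) → ⊥
  crowded H c v small sat has2 has3 with hasNbr-elim H c col2 has2 | hasNbr-elim H c col3 has3
  ... | d₂ , h₂ | d₃ , h₃ = ≤⇒≯ small five-darts
    where
    inH : Dart m → Bool
    inH d = at v d ∧ Subgraph.inE H d
    towards-inH : ∀ t {d} → T (towards H c t v d) → T (inH d)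
    towards-inH t {d} h = let (hd , d∈H , _) = towards-sound H c t h in ∧-join (≟-complete hd) d∈H
    not-towards : ∀ t {d e} → t ≢ col1 → T (towards H c t v e) → T (isCol1 (c (head (α d)))) → d ≢ e
    not-towards t t≢1 h col-1 refl = t≢1 (trans (sym (towards-sound H c t h .proj₂ .proj₂)) (isCol1-sound col-1))
    col1-darts : ∀ d → T (at v d ∧ Subgraph.inE H d ∧ isCol1 (c (head (α d)))) →
      T ((inH without d₂) d) × d ≢ d₃
    col1-darts d h = without-intro inH (∧-join (∧-split {at v d} h .proj₁) (∧-split {Subgraph.inE H d} rest .proj₁))
                                     (not-towards col2 (λ ()) h₂ col-1) ,
                     not-towards col3 (λ ()) h₃ col-1
      where
      rest = ∧-split {at v d} h .proj₂
      col-1 = ∧-split {Subgraph.inE H d} rest .proj₂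
    d₃≢d₂ : d₃ ≢ d₂
    d₃≢d₂ refl
      with trans (sym (towards-sound H c col2 h₂ .proj₂ .proj₂)) (towards-sound H c col3 h₃ .proj₂ .proj₂)
    ... | ()
    d₃-remains : T ((inH without d₂) d₃)
    d₃-remains = without-intro inH (towards-inH col3 h₃) d₃≢d₂
    five-darts : 5 ≤ degIn H v
    five-darts = begin
      5                               ≤⟨ s≤s (s≤s (≰⇒> (toWitnessFalse sat))) ⟩
      suc (suc (ones H c v))          ≤⟨ s≤s (count-drop d₃ d₃-remains col1-darts) ⟩
      suc (countB (inH without d₂))   ≤⟨ count-drop d₂ (towards-inH col2 h₂) (λ d h → without-elim inH h) ⟩
      degIn H v                       ∎
      where open ≤-Reasoning

module Configuration {n m : ℕ} (G : PlaneGraph n m) (noC45 : NoC4C5 G) (critical : Critical G)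
  {u a b w : Fin n} (u~a : Adj G u a) (u~b : Adj G u b) (a~b : Adj G a b) (u~w : Adj G u w)
  (w≢a : w ≢ a) (w≢b : w ≢ b)
  (deg-u : deg G u ≡ 3) (deg-a : deg G a ≡ 3) (deg-b : deg G b ≤ 6) (deg-w : deg G w ≤ 5) where

  open PlaneGraph G

  u≢a : u ≢ a
  u≢a = Adj-irrefl G u~a
  u≢b : u ≢ b
  u≢b = Adj-irrefl G u~b
  u≢w : u ≢ w
  u≢w = Adj-irrefl G u~w
  a≢b : a ≢ b
  a≢b = Adj-irrefl G a~b

  -- N(a) = {u, b, a'}; opaque, as only the stated properties of a' are used
  opaque
    nbhd-a : ∃[ y ] Adj G a y × y ≢ u × y ≢ b × (∀ {z} → Adj G a z → z ≡ u ⊎ z ≡ b ⊎ z ≡ y)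
    nbhd-a = deg3-nbhd G deg-a (Adj-sym G u~a) a~b u≢b

  a' : Fin n
  a' = nbhd-a .proj₁
  a~a' : Adj G a a'
  a~a' = nbhd-a .proj₂ .proj₁
  a'≢u : a' ≢ u
  a'≢u = nbhd-a .proj₂ .proj₂ .proj₁
  a'≢b : a' ≢ b
  a'≢b = nbhd-a .proj₂ .proj₂ .proj₂ .proj₁
  nbrs-a : ∀ {z} → Adj G a z → z ≡ u ⊎ z ≡ b ⊎ z ≡ a'
  nbrs-a = nbhd-a .proj₂ .proj₂ .proj₂ .proj₂

  nbrs-u : ∀ {z} → Adj G u z → z ≡ a ⊎ z ≡ b ⊎ z ≡ w
  nbrs-u u~z with deg3-nbhd G deg-u u~a u~b a≢b
  ... | _ , _ , _ , _ , nbrs with nbrs u~w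
  ... | inj₁ w≡a = ⊥-elim (w≢a w≡a)
  ... | inj₂ (inj₁ w≡b) = ⊥-elim (w≢b w≡b)
  ... | inj₂ (inj₂ refl) = nbrs u~z

  -- the 4-cycles w a b u and w b a u do not exist
  w≁a : ¬ Adj G w a
  w≁a w~a = no-4-cycle G noC45 w~a a~b (Adj-sym G u~b) u~w w≢b (u≢a ∘ sym)
  w≁b : ¬ Adj G w b
  w≁b w~b = no-4-cycle G noC45 w~b (Adj-sym G a~b) (Adj-sym G u~a) u~w w≢a (u≢b ∘ sym)

  a'≢a : a' ≢ a
  a'≢a = Adj-irrefl G a~a' ∘ sym
  a'≢w : a' ≢ w
  a'≢w a'≡w = w≁a (subst (λ z → Adj G z a) a'≡w (Adj-sym G a~a'))
  a'≁u : ¬ Adj G a' u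
  a'≁u a'~u with nbrs-u (Adj-sym G a'~u)
  ... | inj₁ a'≡a = a'≢a a'≡a
  ... | inj₂ (inj₁ a'≡b) = a'≢b a'≡b
  ... | inj₂ (inj₂ a'≡w) = a'≢w a'≡w

  S : Fin n → Bool
  S = pair u a
  H : Subgraph G
  H = delete G S

  in-H : ∀ {z} → z ≢ u → z ≢ a → Subgraph.inV H z ≡ true
  in-H z≢u z≢a = Equivalence.to T-≡ (pair-out z≢u z≢a)

  opaque
    colouring : Colourable300 G H
    colouring = proj₂ critical H (delete-proper G S {u} (pair-fst u a))
  c : Fin n → Colour
  c = colouring .proj₁
  c-ok : Is300Colouring G H c
  c-ok = colouring .proj₂

  -- b loses its edges to u and a, w its edge to u
  degIn-b : degIn G H b ≤ 4
  degIn-b = ≤-pred (≤-pred (≤-trans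
    (degIn-delete₂ G S (Adj-sym G u~b) (Adj-sym G a~b) u≢a (pair-fst u a) (pair-snd u a)) deg-b))
  degIn-w : degIn G H w ≤ 4
  degIn-w = ≤-pred (≤-trans (degIn-delete₁ G S (Adj-sym G u~w) (pair-fst u a)) deg-w)

  local : LocalView
  local = view (c b) (c w) (c a') (saturated G H c b) (saturated G H c w) (saturated G H c a')
               (hasNbr G H c col2 b) (hasNbr G H c col3 b) (hasNbr G H c col2 w) (hasNbr G H c col3 w)

  local-consistent : Consistent local
  local-consistent = record
    { b-no2 = no-same-nbr G H c c-ok col2 (λ ()) ; b-no3 = no-same-nbr G H c c-ok col3 (λ ())
    ; w-no2 = no-same-nbr G H c c-ok col2 (λ ()) ; w-no3 = no-same-nbr G H c c-ok col3 (λ ())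
    ; b-uncrowded = crowded G H c b degIn-b ; w-uncrowded = crowded G H c w degIn-w }

  module Recolouring {nu na nb nw : Colour} (ext : Extension local nu na nb nw) where
    open Extension ext

    c₁ c₂ c₃ c' : Fin n → Colour
    c₁ = c [ w ↦ nw ]
    c₂ = c₁ [ b ↦ nb ]
    c₃ = c₂ [ a ↦ na ]
    c' = c₃ [ u ↦ nu ]

    c'-u : c' u ≡ nu
    c'-u = update-here c₃ u nu
    c'-a : c' a ≡ na
    c'-a = trans (update-there c₃ nu (u≢a ∘ sym)) (update-here c₂ a na)
    c'-b : c' b ≡ nb
    c'-b = trans (update-there c₃ nu (u≢b ∘ sym)) (trans (update-there c₂ na (a≢b ∘ sym)) (update-here c₁ b nb))
    c'-w : c' w ≡ nw
    c'-w = trans (update-there c₃ nu (u≢w ∘ sym))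
             (trans (update-there c₂ na w≢a) (trans (update-there c₁ nb w≢b) (update-here c w nw)))
    c'-elsewhere : ∀ {z} → z ≢ u → z ≢ a → z ≢ b → z ≢ w → c' z ≡ c z
    c'-elsewhere z≢u z≢a z≢b z≢w = trans (update-there c₃ nu z≢u)
      (trans (update-there c₂ na z≢a) (trans (update-there c₁ nb z≢b) (update-there c nw z≢w)))

    read : ∀ {z z' x t} → c' z ≡ x → z' ≡ z → c' z' ≡ t → x ≡ t
    read cz refl cz' = trans (sym cz) cz'

    keeps1 : ∀ z → T (not (S z)) → c' z ≡ col1 → c z ≡ col1
    keeps1 z z∉S cz with toSum (z ≟ᶠ b) | toSum (z ≟ᶠ w)
    ... | inj₁ z≡b | _ = trans (cong c z≡b) (b-keeps1 (read c'-b z≡b cz))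
    ... | inj₂ _ | inj₁ z≡w = trans (cong c z≡w) (w-keeps1 (read c'-w z≡w cz))
    ... | inj₂ z≢b | inj₂ z≢w =
      trans (sym (c'-elsewhere (pair-not z∉S .proj₁) (pair-not z∉S .proj₂) z≢b z≢w)) cz

    onesTo-u : ∀ v → onesTo G c' v u ≤ indicator (isCol1 nu)
    onesTo-u v = ≤-trans (onesTo-≤ G c' v u) (≤-reflexive (cong (indicator ∘ isCol1) c'-u))
    onesTo-a : ∀ v → onesTo G c' v a ≤ indicator (isCol1 na)
    onesTo-a v = ≤-trans (onesTo-≤ G c' v a) (≤-reflexive (cong (indicator ∘ isCol1) c'-a))

    bound-outside : ∀ {v} → v ≢ u → v ≢ a → ∀ {h x y} →
      ones G H c v ≤ h → onesTo G c' v u ≤ x → onesTo G c' v a ≤ y → h + x + y ≤ 3 →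
      ones G (wholeGraph G) c' v ≤ 3
    bound-outside {v} v≢u v≢a {h} {x} {y} from-H from-u from-a sum≤3 = begin
      ones G (wholeGraph G) c' v                          ≤⟨ ones-split G S c' c keeps1 (pair-out v≢u v≢a) ⟩
      ones G H c v + _                                    ≤⟨ +-monoʳ-≤ (ones G H c v) (ones-pair G c' v u a) ⟩
      ones G H c v + (onesTo G c' v u + onesTo G c' v a)  ≤⟨ +-mono-≤ from-H (+-mono-≤ from-u from-a) ⟩
      h + (x + y)                                         ≡⟨ sym (+-assoc h x y) ⟩
      h + x + y                                           ≤⟨ sum≤3 ⟩
      3                                                   ∎
      where open ≤-Reasoning

    cap-H : ∀ {v} → v ≢ u → v ≢ a → c v ≡ col1 → ones G H c v ≤ cap (saturated G H c v)
    cap-H v≢u v≢a = ones-cap G H c c-ok (in-H v≢u v≢a)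

    bound-b : nb ≡ col1 → ones G (wholeGraph G) c' b ≤ 3
    bound-b nb≡1 = bound-outside (u≢b ∘ sym) (a≢b ∘ sym)
      (cap-H (u≢b ∘ sym) (a≢b ∘ sym) (b-keeps1 nb≡1)) (onesTo-u b) (onesTo-a b) (b-room nb≡1)

    bound-w : nw ≡ col1 → ones G (wholeGraph G) c' w ≤ 3
    bound-w nw≡1 = bound-outside (u≢w ∘ sym) w≢a
      (cap-H (u≢w ∘ sym) w≢a (w-keeps1 nw≡1)) (onesTo-u w) (≤-reflexive (onesTo-nonadj G c' w≁a))
      (≤-trans (≤-reflexive (+-identityʳ _)) (w-room nw≡1))

    bound-a' : c a' ≡ col1 → ones G (wholeGraph G) c' a' ≤ 3
    bound-a' ca'≡1 = bound-outside a'≢u a'≢a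
      (cap-H a'≢u a'≢a ca'≡1) (≤-reflexive (onesTo-nonadj G c' a'≁u)) (onesTo-a a')
      (≤-trans (≤-reflexive (cong (_+ indicator (isCol1 na)) (+-identityʳ _))) (a'-room ca'≡1))

    -- any other vertex has no neighbour among u and a
    bound-rest : ∀ {v} → v ≢ u → v ≢ a → v ≢ b → v ≢ w → v ≢ a' → c v ≡ col1 →
      ones G (wholeGraph G) c' v ≤ 3
    bound-rest {v} v≢u v≢a v≢b v≢w v≢a' cv≡1 = bound-outside v≢u v≢a
      (proj₁ c-ok v (in-H v≢u v≢a) cv≡1) (≤-reflexive (onesTo-nonadj G c' v≁u))
      (≤-reflexive (onesTo-nonadj G c' v≁a)) ≤-refl
      where
      v≁u : ¬ Adj G v u
      v≁u v~u = [ v≢a , [ v≢b , v≢w ] ] (nbrs-u (Adj-sym G v~u))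
      v≁a : ¬ Adj G v a
      v≁a v~a = [ v≢u , [ v≢b , v≢a' ] ] (nbrs-a (Adj-sym G v~a))

    ones-ok : ∀ v → c' v ≡ col1 → ones G (wholeGraph G) c' v ≤ 3
    ones-ok v cv with toSum (v ≟ᶠ u) | toSum (v ≟ᶠ a) | toSum (v ≟ᶠ b) | toSum (v ≟ᶠ w) | toSum (v ≟ᶠ a')
    ... | inj₁ refl | _ | _ | _ | _ = ≤-trans (ones-≤-deg G (wholeGraph G) c' u) (≤-reflexive deg-u)
    ... | inj₂ _ | inj₁ refl | _ | _ | _ = ≤-trans (ones-≤-deg G (wholeGraph G) c' a) (≤-reflexive deg-a)
    ... | inj₂ _ | inj₂ _ | inj₁ refl | _ | _ = bound-b (trans (sym c'-b) cv)
    ... | inj₂ _ | inj₂ _ | inj₂ _ | inj₁ refl | _ = bound-w (trans (sym c'-w) cv)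
    ... | inj₂ _ | inj₂ _ | inj₂ _ | inj₂ _ | inj₁ refl =
      bound-a' (trans (sym (c'-elsewhere a'≢u a'≢a a'≢b a'≢w)) cv)
    ... | inj₂ v≢u | inj₂ v≢a | inj₂ v≢b | inj₂ v≢w | inj₂ v≢a' =
      bound-rest v≢u v≢a v≢b v≢w v≢a' (trans (sym (c'-elsewhere v≢u v≢a v≢b v≢w)) cv)

    Mono : Colour → Dart m → Set
    Mono t d = c' (head d) ≡ t × c' (head (α d)) ≡ t

    mono-flip : ∀ {t d} → Mono t d → Mono t (α d)
    mono-flip {d = d} (hd , tl) = tl , subst (λ e → c' (head e) ≡ _) (sym (α-inv d)) hd

    at-u : ∀ {t d} → t ≢ col1 → head d ≡ u → ¬ Mono t d
    at-u {t} {d} t≢1 hd≡u (hd , tl) with nbrs-u (d , hd≡u , refl)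
    ... | inj₁ tl≡a = u-a t t≢1 (read c'-u hd≡u hd) (read c'-a tl≡a tl)
    ... | inj₂ (inj₁ tl≡b) = u-b t t≢1 (read c'-u hd≡u hd) (read c'-b tl≡b tl)
    ... | inj₂ (inj₂ tl≡w) = u-w t t≢1 (read c'-u hd≡u hd) (read c'-w tl≡w tl)

    at-a : ∀ {t d} → t ≢ col1 → head d ≡ a → ¬ Mono t d
    at-a {t} {d} t≢1 hd≡a (hd , tl) with nbrs-a (d , hd≡a , refl)
    ... | inj₁ tl≡u = u-a t t≢1 (read c'-u tl≡u tl) (read c'-a hd≡a hd)
    ... | inj₂ (inj₁ tl≡b) = a-b t t≢1 (read c'-a hd≡a hd) (read c'-b tl≡b tl)
    ... | inj₂ (inj₂ tl≡a') = a-a' t t≢1 (read c'-a hd≡a hd)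
                                 (read (c'-elsewhere a'≢u a'≢a a'≢b a'≢w) tl≡a' tl)

    b-avoids : ∀ t → t ≢ col1 → nb ≡ t → ¬ T (hasNbr G H c t b)
    b-avoids col1 t≢1 _ = ⊥-elim (t≢1 refl)
    b-avoids col2 _ = b-avoids2
    b-avoids col3 _ = b-avoids3

    w-avoids : ∀ t → t ≢ col1 → nw ≡ t → ¬ T (hasNbr G H c t w)
    w-avoids col1 t≢1 _ = ⊥-elim (t≢1 refl)
    w-avoids col2 _ = w-avoids2
    w-avoids col3 _ = w-avoids3

    far-colour : ∀ {d} → head d ≡ b ⊎ head d ≡ w → T (Subgraph.inE H d) → c' (head (α d)) ≡ c (head (α d))
    far-colour {d} at-bw d∈H = c'-elsewhere (tail∉S .proj₁) (tail∉S .proj₂) tl≢b tl≢w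
      where
      tail∉S = pair-not (deleted-tail G S d∈H)
      loop : ∀ {x} → head d ≡ x → head (α d) ≢ x
      loop hd≡x tl≡x = no-loop d (trans tl≡x (sym hd≡x))
      tl≢b : head (α d) ≢ b
      tl≢b = [ loop , (λ hd≡w tl≡b → w≁b (d , hd≡w , tl≡b)) ] at-bw
      tl≢w : head (α d) ≢ w
      tl≢w = [ (λ hd≡b tl≡w → w≁b (α d , tl≡w , trans (cong head (α-inv d)) hd≡b)) , loop ] at-bw

    at-b : ∀ {t d} → t ≢ col1 → head d ≡ b → T (Subgraph.inE H d) → ¬ Mono t d
    at-b {t} {d} t≢1 hd≡b d∈H (hd , tl) = b-avoids t t≢1 (read c'-b hd≡b hd)
      (hasNbr-intro G H c t (∧-join (≟-complete hd≡b)
        (∧-join d∈H (is-complete (trans (sym (far-colour (inj₁ hd≡b) d∈H)) tl)))))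

    at-w : ∀ {t d} → t ≢ col1 → head d ≡ w → T (Subgraph.inE H d) → ¬ Mono t d
    at-w {t} {d} t≢1 hd≡w d∈H (hd , tl) = w-avoids t t≢1 (read c'-w hd≡w hd)
      (hasNbr-intro G H c t (∧-join (≟-complete hd≡w)
        (∧-join d∈H (is-complete (trans (sym (far-colour (inj₂ hd≡w) d∈H)) tl)))))

    elsewhere : ∀ {t d} → t ≢ col1 → T (Subgraph.inE H d) →
      head d ≢ b → head d ≢ w → head (α d) ≢ b → head (α d) ≢ w → ¬ Mono t d
    elsewhere {t} {d} t≢1 d∈H hd≢b hd≢w tl≢b tl≢w (hd , tl) =
      no-mono-edge G H c c-ok t t≢1 d (Equivalence.to T-≡ d∈H)
        ( trans (sym (c'-elsewhere (hd∉S .proj₁) (hd∉S .proj₂) hd≢b hd≢w)) hd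
        , trans (sym (c'-elsewhere (tl∉S .proj₁) (tl∉S .proj₂) tl≢b tl≢w)) tl )
      where
      hd∉S = pair-not (∧-split {not (S (head d))} d∈H .proj₁)
      tl∉S = pair-not (deleted-tail G S d∈H)

    H-edge : ∀ {t d} → t ≢ col1 → T (Subgraph.inE H d) → ¬ Mono t d
    H-edge {t} {d} t≢1 d∈H
      with toSum (head d ≟ᶠ b) | toSum (head d ≟ᶠ w) | toSum (head (α d) ≟ᶠ b) | toSum (head (α d) ≟ᶠ w)
    ... | inj₁ hd≡b | _ | _ | _ = at-b t≢1 hd≡b d∈H
    ... | inj₂ _ | inj₁ hd≡w | _ | _ = at-w t≢1 hd≡w d∈H
    ... | inj₂ _ | inj₂ _ | inj₁ tl≡b | _ = at-b t≢1 tl≡b αd∈H ∘ mono-flip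
      where αd∈H = subst T (sym (Subgraph.inE-α H d)) d∈H
    ... | inj₂ _ | inj₂ _ | inj₂ _ | inj₁ tl≡w = at-w t≢1 tl≡w αd∈H ∘ mono-flip
      where αd∈H = subst T (sym (Subgraph.inE-α H d)) d∈H
    ... | inj₂ hd≢b | inj₂ hd≢w | inj₂ tl≢b | inj₂ tl≢w = elsewhere t≢1 d∈H hd≢b hd≢w tl≢b tl≢w

    no-mono : NoMonoEdge G (wholeGraph G) c'
    no-mono t t≢1 d _
      with toSum (head d ≟ᶠ u) | toSum (head d ≟ᶠ a) | toSum (head (α d) ≟ᶠ u) | toSum (head (α d) ≟ᶠ a)
    ... | inj₁ hd≡u | _ | _ | _ = at-u t≢1 hd≡u
    ... | inj₂ _ | inj₁ hd≡a | _ | _ = at-a t≢1 hd≡a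
    ... | inj₂ _ | inj₂ _ | inj₁ tl≡u | _ = at-u t≢1 tl≡u ∘ mono-flip
    ... | inj₂ _ | inj₂ _ | inj₂ _ | inj₁ tl≡a = at-a t≢1 tl≡a ∘ mono-flip
    ... | inj₂ hd≢u | inj₂ hd≢a | inj₂ tl≢u | inj₂ tl≢a =
      H-edge t≢1 (∧-join (pair-out hd≢u hd≢a) (pair-out tl≢u tl≢a))

    c'-colouring : Is300Colouring G (wholeGraph G) c'
    c'-colouring = colouring-intro G (wholeGraph G) c' (λ v _ → ones-ok v) no-mono

  impossible : ⊥
  impossible =
    let (_ , _ , _ , _ , ext) = extension local local-consistent
    in proj₁ critical (Recolouring.c' ext , Recolouring.c'-colouring ext)

rotate : ∀ {A : Set} {x y z v : A} → v ≡ x ⊎ v ≡ y ⊎ v ≡ z → v ≡ y ⊎ v ≡ z ⊎ v ≡ x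
rotate (inj₁ e) = inj₂ (inj₂ e)
rotate (inj₂ (inj₁ e)) = inj₁ e
rotate (inj₂ (inj₂ e)) = inj₂ (inj₁ e)

rotate⁻ : ∀ {A : Set} {x y z v : A} → v ≡ y ⊎ v ≡ z ⊎ v ≡ x → v ≡ x ⊎ v ≡ y ⊎ v ≡ z
rotate⁻ (inj₁ e) = inj₂ (inj₁ e)
rotate⁻ (inj₂ (inj₁ e)) = inj₂ (inj₂ e)
rotate⁻ (inj₂ (inj₂ e)) = inj₁ e

module _ {n m : ℕ} (G : PlaneGraph n m) where
  open PlaneGraph G

  face-triangle : ∀ {d} → Is3Face G d →
    Adj G (head d) (head (φ d)) × Adj G (head (φ d)) (head (φ (φ d))) × Adj G (head (φ (φ d))) (head d)
  face-triangle {d} (φ³≡id , _) =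
    (d , refl , sym (σ-head (α d))) ,
    (φ d , refl , sym (σ-head (α (φ d)))) ,
    (φ (φ d) , refl , trans (sym (σ-head (α (φ (φ d))))) (cong head φ³≡id))

  -- In a triangle p q r with deg p = deg q = 3 and deg r ≤ 6, a neighbour w off the
  -- triangle of a degree-3 vertex u of it has degree at least 6: otherwise u, the
  -- other degree-3 vertex, the remaining vertex and w form the reducible configuration.
  triangle-pendant : NoC4C5 G → Critical G → ∀ {p q r u w} →
    Adj G p q → Adj G q r → Adj G r p → deg G p ≡ 3 → deg G q ≡ 3 → deg G r ≤ 6 →
    u ≡ p ⊎ u ≡ q ⊎ u ≡ r → deg G u ≡ 3 → Adj G u w → ¬ (w ≡ p ⊎ w ≡ q ⊎ w ≡ r) → 6 ≤ deg G w
  triangle-pendant noC45 critical {p} {q} {r} {u} {w} pq qr rp deg-p deg-q deg-r u-on deg-u uw w-off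
    with 6 ≤? deg G w
  ... | yes heavy = heavy
  ... | no light = ⊥-elim (reducible u-on)
    where
    deg-w : deg G w ≤ 5
    deg-w = ≤-pred (≰⇒> light)
    reducible : u ≡ p ⊎ u ≡ q ⊎ u ≡ r → ⊥
    reducible (inj₁ refl) = Configuration.impossible G noC45 critical pq (Adj-sym G rp) qr uw
      (w-off ∘ inj₂ ∘ inj₁) (w-off ∘ inj₂ ∘ inj₂) deg-u deg-q deg-r deg-w
    reducible (inj₂ (inj₁ refl)) = Configuration.impossible G noC45 critical (Adj-sym G pq) qr (Adj-sym G rp) uw
      (w-off ∘ inj₁) (w-off ∘ inj₂ ∘ inj₂) deg-u deg-p deg-r deg-w
    reducible (inj₂ (inj₂ refl)) = Configuration.impossible G noC45 critical rp (Adj-sym G qr) pq uw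
      (w-off ∘ inj₁) (w-off ∘ inj₂ ∘ inj₁) deg-u deg-p (≤-trans (≤-reflexive deg-q) (+-monoʳ-≤ 3 z≤n)) deg-w

lemma3p3 : {n m : ℕ} (G : PlaneGraph n m) → NoC4C5 G → Critical G →
    ∀ d → Is336Face G d → NonPoor G d
lemma3p3 G noC45 critical d (face , degrees) u u-on deg-u w uw w-off with face-triangle G face | degrees
... | xy , yz , zx | inj₁ (dx , dy , dz) =
  triangle-pendant G noC45 critical xy yz zx dx dy dz u-on deg-u uw w-off
... | xy , yz , zx | inj₂ (inj₁ (dy , dz , dx)) =
  triangle-pendant G noC45 critical yz zx xy dy dz dx (rotate u-on) deg-u uw (w-off ∘ rotate⁻)
... | xy , yz , zx | inj₂ (inj₂ (dz , dx , dy)) =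
  triangle-pendant G noC45 critical zx xy yz dz dx dy (rotate (rotate u-on)) deg-u uw
    (w-off ∘ rotate⁻ ∘ rotate⁻)
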